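{- Let $G=(V,E)$ be a graph, $B$ a set of terminal pairs, and let $M,M'$ be minimal node multicuts of $(G,B)$. Then $M=M'$ if and only if $\mathrm{dist}(M,M')=0$.
   Context: Graphs are finite, undirected, connected, simple. $B$ is a set of unordered vertex pairs, $T=T(B)$ the set of vertices in them. A node multicut of $(G,B)$ is $M\subseteq V\setminus T$ such that $G-M$ has no path between $s$ and $t$ for any $\{s,t\}\in B$; minimal means no proper subset is a node multicut. For a node multicut $M$, $\mathcal C_M$ denotes the set of connected components of $G-M$ that contain at least one terminal. Fix a total order on $V$. For a vertex set $C'$ and node multicut $M$, $\mathrm{mcc}(C',M)$ is the connected component $C$ of $G-M$ minimizing $|C'\setminus C|$, ties broken by choosing the component containing the smallest vertex in the fixed order. For node multicuts $M,M'$, $\mathrm{dist}(M,M')=\sum_{C'\in\mathcal C_{M'}}|C'\setminus \mathrm{mcc}(C',M)|$. -}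

module Defs where

open import Data.Nat as ℕ using (ℕ; zero; suc; _+_; _<ᵇ_; _≡ᵇ_)
open import Data.Bool using (Bool; true; false; _∧_; _∨_; not; if_then_else_)
open import Data.Fin using (Fin; toℕ)
open import Data.Fin.Subset using (Subset; _∈_; _∉_; _⊂_; ⊥; ⁅_⁆; _∩_; _∪_; ∁; ∣_∣)
open import Data.Vec using (Vec; tabulate; lookup)
open import Data.Vec.Properties using (≡-dec)
import Data.Bool.Properties as BoolP
open import Data.List using (List; []; _∷_; foldr; map; filter)
open import Data.Bool.ListAction using (any)
open import Data.Nat.ListAction using (sum)
open import Data.List.Base using (concatMap)
open import Data.List.Membership.Propositional using () renaming (_∈_ to _∈ₗ_)
open import Data.Product using (_×_; _,_; proj₁; proj₂; Σ)
open import Data.Maybe using (Maybe; just; nothing; fromMaybe)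
open import Data.Empty renaming (⊥ to Empty)
open import Relation.Nullary using (¬_; does; ¬?)
open import Relation.Binary.PropositionalEquality using (_≡_; _≢_)
open import Function.Definitions using (Injective)
open import Data.List.Base using () renaming (allFin to allFinL)

record Graph (n : ℕ) : Set where
  field
    adj       : Fin n → Fin n → Bool
    symmetric : ∀ u v → adj u v ≡ adj v u
    irreflex  : ∀ v → adj v v ≡ false

module _ {n : ℕ} (G : Graph n) where
  open Graph G

  data PathAvoiding (M : Subset n) : Fin n → Fin n → Set where
    here : ∀ {v} → v ∉ M → PathAvoiding M v v
    step : ∀ {u w t} → adj u w ≡ true → u ∉ M →
           PathAvoiding M w t → PathAvoiding M u t

  Connected : Set
  Connected = ∀ u v → PathAvoiding ⊥ u v

Pairs : ℕ → Set
Pairs n = List (Fin n × Fin n)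

terminals : ∀ {n} → Pairs n → Subset n
terminals B = foldr (λ p S → ⁅ proj₁ p ⁆ ∪ (⁅ proj₂ p ⁆ ∪ S)) ⊥ B

terminalList : ∀ {n} → Pairs n → List (Fin n)
terminalList B = concatMap (λ p → proj₁ p ∷ proj₂ p ∷ []) B

module _ {n : ℕ} (G : Graph n) (B : Pairs n) where
  open Graph G

  IsNodeMulticut : Subset n → Set
  IsNodeMulticut M =
    (∀ v → v ∈ M → v ∉ terminals B) ×
    (∀ s t → (s , t) ∈ₗ B → ¬ PathAvoiding G M s t)

  IsMinimalNodeMulticut : Subset n → Set
  IsMinimalNodeMulticut M =
    IsNodeMulticut M × (∀ M'' → M'' ⊂ M → ¬ IsNodeMulticut M'')

module _ {n : ℕ} (G : Graph n) where
  open Graph G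

  private
    inB : Fin n → Subset n → Bool
    inB v S = lookup S v

  grow : Subset n → Subset n → Subset n
  grow M R = tabulate λ u →
    inB u R ∨ (not (inB u M) ∧ any (λ w → inB w R ∧ adj w u) (allFinL n))

  iter : ℕ → Subset n → Subset n → Subset n
  iter zero    M R = R
  iter (suc k) M R = grow M (iter k M R)

  -- the connected component of G - M containing v (empty if v ∈ M);
  -- n closure steps suffice since a path has < n edges.
  component : Subset n → Fin n → Subset n
  component M v = iter n M (if inB v M then ⊥ else ⁅ v ⁆)

  -- all connected components of G - M, listed (with repetitions) via their vertices
  allComponents : Subset n → List (Subset n)
  allComponents M = map (component M) (filter (λ v → Data.Bool._≟_ (lookup M v) false) (allFinL n))

  dedup : List (Subset n) → List (Subset n)
  dedup [] = []
  dedup (C ∷ Cs) =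
    C ∷ filter (λ D → ¬? (≡-dec BoolP._≟_ C D)) (dedup Cs)

  terminalComponents : Pairs n → Subset n → List (Subset n)
  terminalComponents B M = dedup (map (component M) (terminalList B))

  -- the fixed total order on V, given by an injective rank σ : V → Fin n
  module Ordered (σ : Fin n → Fin n) where

    -- smallest rank of a vertex in C (n if C is empty)
    minRank : Subset n → ℕ
    minRank C = foldr (λ v m → if inB v C ∧ (toℕ (σ v) <ᵇ m) then toℕ (σ v) else m)
                      n (allFinL n)

    mcc : Subset n → Subset n → Subset n
    mcc C' M = fromMaybe ⊥ (foldr pick nothing (allComponents M))
      where
      score : Subset n → ℕ
      score C = ∣ C' ∩ ∁ C ∣
      better : Subset n → Subset n → Bool
      better C D = (score C <ᵇ score D) ∨
                   ((score C ≡ᵇ score D) ∧ (minRank C <ᵇ minRank D))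
      pick : Subset n → Maybe (Subset n) → Maybe (Subset n)
      pick C nothing  = just C
      pick C (just D) = if better C D then just C else just D

    dist : Pairs n → Subset n → Subset n → ℕ
    dist B M M' = sum (map (λ C' → ∣ C' ∩ ∁ (mcc C' M) ∣) (terminalComponents B M'))

-- If dist(M, M′) = 0, every terminal component C′ of G − M′ lies inside mcc(C′, M), which is a
-- component of G − M; so the terminal components of G − M′ miss M. Then no m ∈ M′ ∖ M is needed in
-- M′: an s–t path of G − (M′ ∖ {m}) either avoids M′, or runs inside the component of s in G − M′
-- up to its first visit to m and inside the component of t after its last one, and these two
-- pieces joined through m ∉ M form an s–t path of G − M. Minimality of M′ gives M′ ⊆ M, and
-- minimality of M then gives M′ = M. Conversely, every terminal component of G − M is its own mcc
-- with respect to M, so dist(M, M) = 0.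
module Submission where

open import Defs
open import Data.Nat using (ℕ; zero; suc; _<ᵇ_; _≡ᵇ_; _≤_; _<_; z≤n)
open import Data.Nat.Properties
  using (≤-refl; ≤-reflexive; ≤-trans; <-≤-trans; ≤-<-trans; <⇒≤; <⇒≱; ≮⇒≥; <ᵇ⇒<; <⇒<ᵇ; ≡ᵇ⇒≡;
         n≤0⇒n≡0; m+n≡0⇒m≡0; m+n≡0⇒n≡0)
open import Data.Nat.ListAction using (sum)
open import Data.Bool using (Bool; true; false; _∧_; _∨_; not; if_then_else_; T)
open import Data.Bool.Properties using (T-∨; T-∧; T-≡; T-not-≡) renaming (_≟_ to _≟ᵇ_)
open import Data.Fin using (Fin) renaming (_≟_ to _≟ᶠ_)
open import Data.Fin.Subset using (Subset; _∈_; _∉_; _⊆_; _⊂_; ⊥; ⁅_⁆; _∩_; ∁; ∣_∣; _-_)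
open import Data.Fin.Subset.Properties
  using (_∈?_; _⊂?_; ⊆-antisym; ∉⊥; x∈⁅x⁆; x∈⁅y⁆⇒x≡y; ∣⁅x⁆∣≡1; p⊆q⇒∣p∣≤∣q∣; p⊂q⇒∣p∣<∣q∣; ∣p∣≤n;
         ∣⊥∣≡0; ∩-inverseʳ; x∈p∩q⁺; x∈p∪q⁺; x∉p⇒x∈∁p; x∈p∧x≢y⇒x∈p-y; x∈p⇒p-x⊂p; p⊂q⇒p⊆q)
open import Data.Vec using (lookup)
open import Data.Vec.Properties using ([]=⇒lookup; lookup⇒[]=; lookup∘tabulate; ≡-dec)
open import Data.List using (List; []; _∷_; foldr; map)
open import Data.List.Properties using (foldr-cong)
open import Data.List.Membership.Propositional using (lose) renaming (_∈_ to _∈ₗ_)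
open import Data.List.Membership.Propositional.Properties
  using (∈-allFin; ∈-map⁺; ∈-map⁻; ∈-filter⁺; ∈-filter⁻)
open import Data.List.Relation.Unary.Any using (here; there)
open import Data.List.Relation.Unary.Any.Properties using (any⁺)
open import Data.Maybe using (Maybe; just; nothing; fromMaybe)
open import Data.Maybe.Properties using (just-injective)
open import Data.Product using (_×_; _,_; proj₁; proj₂; ∃-syntax; ∃₂)
open import Data.Sum using (_⊎_; inj₁; inj₂; [_,_]′)
open import Function.Base using (id)
open import Function.Bundles using (_⇔_; mk⇔; Equivalence)
open import Function.Definitions using (Injective)
open import Relation.Nullary using (¬_; Dec; yes; no; contradiction)
open import Relation.Nullary.Decidable using (decidable-stable)
open import Relation.Binary.PropositionalEquality
  using (_≡_; _≢_; refl; sym; trans; cong; subst; module ≡-Reasoning)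

open Equivalence using (to; from)

private
  variable
    n : ℕ
    x y : Fin n
    p q : Subset n

∈⇒T : x ∈ p → T (lookup p x)
∈⇒T x∈p = from T-≡ ([]=⇒lookup x∈p)

T⇒∈ : T (lookup p x) → x ∈ p
T⇒∈ {p = p} {x} t = lookup⇒[]= x p (to T-≡ t)

∈-fromMaybe⊥ : ∀ {r : Maybe (Subset n)} → x ∈ fromMaybe ⊥ r → ∃[ p ] r ≡ just p × x ∈ p
∈-fromMaybe⊥ {r = nothing} x∈⊥ = contradiction x∈⊥ ∉⊥
∈-fromMaybe⊥ {r = just p}  x∈p = p , refl , x∈p

∉⇒lookup≡false : x ∉ p → lookup p x ≡ false
∉⇒lookup≡false {x = x} {p} x∉p with lookup p x in eq
... | true  = contradiction (lookup⇒[]= x p eq) x∉p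
... | false = refl

lookup≡false⇒∉ : lookup p x ≡ false → x ∉ p
lookup≡false⇒∉ eq x∈p with trans (sym ([]=⇒lookup x∈p)) eq
... | ()

x∉p-y∧x≢y⇒x∉p : x ∉ p - y → x ≢ y → x ∉ p
x∉p-y∧x≢y⇒x∉p x∉p-y x≢y x∈p = x∉p-y (x∈p∧x≢y⇒x∈p-y x∈p x≢y)

x∈p⇒0<∣p∣ : x ∈ p → 0 < ∣ p ∣
x∈p⇒0<∣p∣ {x = x} {p} x∈p = <-≤-trans (≤-reflexive (sym (∣⁅x⁆∣≡1 x))) (p⊆q⇒∣p∣≤∣q∣ ⁅x⁆⊆p)
  where
  ⁅x⁆⊆p : ⁅ x ⁆ ⊆ p
  ⁅x⁆⊆p y∈⁅x⁆ = subst (_∈ p) (sym (x∈⁅y⁆⇒x≡y x y∈⁅x⁆)) x∈p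

∣p∩∁q∣≡0⇒p⊆q : ∣ p ∩ ∁ q ∣ ≡ 0 → p ⊆ q
∣p∩∁q∣≡0⇒p⊆q {q = q} ∣p∩∁q∣≡0 {x} x∈p = decidable-stable (x ∈? q) λ x∉q →
  <⇒≱ (x∈p⇒0<∣p∣ (x∈p∩q⁺ (x∈p , x∉p⇒x∈∁p x∉q))) (≤-reflexive ∣p∩∁q∣≡0)

∣p∩∁p∣≡0 : ∀ (p : Subset n) → ∣ p ∩ ∁ p ∣ ≡ 0
∣p∩∁p∣≡0 {n} p = trans (cong ∣_∣ (∩-inverseʳ p)) (∣⊥∣≡0 n)

⊆⇒≡⊎⊂ : p ⊆ q → p ≡ q ⊎ p ⊂ q
⊆⇒≡⊎⊂ {p = p} {q} p⊆q with p ⊂? q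
... | yes p⊂q = inj₂ p⊂q
... | no  p⊄q = inj₁ (⊆-antisym p⊆q λ {x} x∈q →
  decidable-stable (x ∈? p) λ x∉p → p⊄q (p⊆q , x , x∈q , x∉p))

iteration-stabilises : (f : Subset n → Subset n) → (∀ p → p ⊆ f p) →
                       (s : ℕ → Subset n) → (∀ k → s (suc k) ≡ f (s k)) →
                       f (s n) ≡ s n
iteration-stabilises {n} f f-inflationary s s-suc =
  [ id , (λ n<∣fsₙ∣ → contradiction (∣p∣≤n (f (s n))) (<⇒≱ n<∣fsₙ∣)) ]′ (fixed-or-growing n)
  where
  open ≡-Reasoning
  fixed-or-growing : ∀ k → f (s k) ≡ s k ⊎ k < ∣ f (s k) ∣
  fixed-or-growing zero with ⊆⇒≡⊎⊂ (f-inflationary (s zero))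
  ... | inj₁ s₀≡fs₀ = inj₁ (sym s₀≡fs₀)
  ... | inj₂ s₀⊂fs₀ = inj₂ (≤-<-trans z≤n (p⊂q⇒∣p∣<∣q∣ s₀⊂fs₀))
  fixed-or-growing (suc k) with fixed-or-growing k
  ... | inj₁ fixed = inj₁ (begin
        f (s (suc k)) ≡⟨ cong f (trans (s-suc k) fixed) ⟩
        f (s k)       ≡⟨ sym (s-suc k) ⟩
        s (suc k)     ∎)
  ... | inj₂ k<∣fsₖ∣ with ⊆⇒≡⊎⊂ (f-inflationary (s (suc k)))
  ...   | inj₁ s≡fs = inj₁ (sym s≡fs)
  ...   | inj₂ s⊂fs = inj₂ (≤-<-trans (subst (k <_) (cong ∣_∣ (sym (s-suc k))) k<∣fsₖ∣)
                                      (p⊂q⇒∣p∣<∣q∣ s⊂fs))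

lexLess : {A : Set} → (A → ℕ) → (A → ℕ) → A → A → Bool
lexLess f g a b = (f a <ᵇ f b) ∨ ((f a ≡ᵇ f b) ∧ (g a <ᵇ g b))

argminStep : {A : Set} → (A → A → Bool) → A → Maybe A → Maybe A
argminStep _<?_ a nothing  = just a
argminStep _<?_ a (just b) = if a <? b then just a else just b

argmin : {A : Set} → (A → A → Bool) → List A → Maybe A
argmin _<?_ = foldr (argminStep _<?_) nothing

argmin-∈ : {A : Set} (_<?_ : A → A → Bool) (as : List A) {a : A} →
           argmin _<?_ as ≡ just a → a ∈ₗ as
argmin-∈ _<?_ (b ∷ bs) eq with argmin _<?_ bs in eq′
... | nothing = here (sym (just-injective eq))
... | just c with b <? c
...   | true  = here (sym (just-injective eq))
...   | false = there (argmin-∈ _<?_ bs (trans eq′ eq))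

module _ {A : Set} (f g : A → ℕ) where

  lexLess⇒≤ : ∀ {a b} → T (lexLess f g a b) → f a ≤ f b
  lexLess⇒≤ {a} {b} t with to T-∨ t
  ... | inj₁ fa<fb = <⇒≤ (<ᵇ⇒< (f a) (f b) fa<fb)
  ... | inj₂ ties  = ≤-reflexive (≡ᵇ⇒≡ (f a) (f b) (proj₁ (to T-∧ ties)))

  ¬lexLess⇒≥ : ∀ {a b} → ¬ T (lexLess f g a b) → f b ≤ f a
  ¬lexLess⇒≥ ¬t = ≮⇒≥ λ fa<fb → ¬t (from T-∨ (inj₁ (<⇒<ᵇ fa<fb)))

  argminStep-≤ : ∀ a r → ∃[ m ] argminStep (lexLess f g) a r ≡ just m × f m ≤ f a ×
                                 (∀ {b} → r ≡ just b → f m ≤ f b)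
  argminStep-≤ a nothing  = a , refl , ≤-refl , λ ()
  argminStep-≤ a (just b) with lexLess f g a b in a<b
  ... | true  = a , refl , ≤-refl , λ { refl → lexLess⇒≤ (from T-≡ a<b) }
  ... | false = b , refl , ¬lexLess⇒≥ (subst T a<b) , λ { refl → ≤-refl }

  argmin-minimal : ∀ (as : List A) {b} → b ∈ₗ as →
                   ∃[ m ] argmin (lexLess f g) as ≡ just m × f m ≤ f b
  argmin-minimal (a ∷ as) (here refl) =
    let m , eq , m≤a , _ = argminStep-≤ a (argmin (lexLess f g) as) in m , eq , m≤a
  argmin-minimal (a ∷ as) (there b∈as) =
    let c , eq′ , c≤b    = argmin-minimal as b∈as
        m , eq , _ , m≤c = argminStep-≤ a (argmin (lexLess f g) as)
    in m , eq , ≤-trans (m≤c eq′) c≤b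

module _ {A : Set} (f : A → ℕ) where

  sum-map-≡0⁻ : ∀ (as : List A) → sum (map f as) ≡ 0 → ∀ {a} → a ∈ₗ as → f a ≡ 0
  sum-map-≡0⁻ (b ∷ bs) Σ≡0 (here refl)  = m+n≡0⇒m≡0 (f b) Σ≡0
  sum-map-≡0⁻ (b ∷ bs) Σ≡0 (there a∈bs) = sum-map-≡0⁻ bs (m+n≡0⇒n≡0 (f b) Σ≡0) a∈bs

  sum-map-≡0⁺ : ∀ (as : List A) → (∀ {a} → a ∈ₗ as → f a ≡ 0) → sum (map f as) ≡ 0
  sum-map-≡0⁺ []       _    = refl
  sum-map-≡0⁺ (b ∷ bs) all0 rewrite all0 (here refl) = sum-map-≡0⁺ bs (λ a∈bs → all0 (there a∈bs))

module _ (G : Graph n) where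
  open Graph G

  grow-inflationary : ∀ M R → R ⊆ grow G M R
  grow-inflationary M R {u} u∈R =
    T⇒∈ (subst T (sym (lookup∘tabulate _ u)) (from T-∨ (inj₁ (∈⇒T u∈R))))

  ∈-grow⁺ : ∀ {M R w u} → w ∈ R → adj w u ≡ true → u ∉ M → u ∈ grow G M R
  ∈-grow⁺ {M} {R} {w} {u} w∈R wu u∉M =
    T⇒∈ (subst T (sym (lookup∘tabulate _ u))
      (from T-∨ (inj₂ (from T-∧ (from T-not-≡ (∉⇒lookup≡false u∉M) ,
        any⁺ _ (lose (∈-allFin w) (from T-∧ (∈⇒T w∈R , from T-≡ wu))))))))

  ∈-grow⁻ : ∀ {M R u} → u ∈ grow G M R → u ∈ R ⊎ u ∉ M
  ∈-grow⁻ {M} {R} {u} u∈grow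
    with to T-∨ (subst T (lookup∘tabulate _ u) (∈⇒T u∈grow))
  ... | inj₁ u∈R    = inj₁ (T⇒∈ u∈R)
  ... | inj₂ u∈new = inj₂ (lookup≡false⇒∉ (to T-not-≡ (proj₁ (to T-∧ u∈new))))

  iter-inflationary : ∀ k M R → R ⊆ iter G k M R
  iter-inflationary zero    M R u∈R = u∈R
  iter-inflationary (suc k) M R u∈R = grow-inflationary M _ (iter-inflationary k M R u∈R)

  iter-avoids : ∀ k M R → (∀ {u} → u ∈ R → u ∉ M) → ∀ {u} → u ∈ iter G k M R → u ∉ M
  iter-avoids zero    M R R-avoids u∈R = R-avoids u∈R
  iter-avoids (suc k) M R R-avoids u∈iter with ∈-grow⁻ u∈iter
  ... | inj₁ u∈iterₖ = iter-avoids k M R R-avoids u∈iterₖ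
  ... | inj₂ u∉M     = u∉M

  -- The seed used by component in Defs, so that component G M v is definitionally
  -- iter G n M (componentSeed M v).
  componentSeed : Subset n → Fin n → Subset n
  componentSeed M v = if lookup M v then ⊥ else ⁅ v ⁆

  component-avoids : ∀ M v {u} → u ∈ component G M v → u ∉ M
  component-avoids M v = iter-avoids n M (componentSeed M v) seed-avoids
    where
    seed-avoids : ∀ {u} → u ∈ componentSeed M v → u ∉ M
    seed-avoids {u} u∈seed with lookup M v in v∈?M
    ... | true  = contradiction u∈seed ∉⊥
    ... | false = subst (_∉ M) (sym (x∈⁅y⁆⇒x≡y v u∈seed)) (lookup≡false⇒∉ v∈?M)

  component-self : ∀ M v → v ∉ M → v ∈ component G M v
  component-self M v v∉M = iter-inflationary n M (componentSeed M v)
    (subst (λ b → v ∈ (if b then ⊥ else ⁅ v ⁆)) (sym (∉⇒lookup≡false v∉M)) (x∈⁅x⁆ v))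

  Closed : Subset n → Subset n → Set
  Closed M C = ∀ {u w} → u ∈ C → adj u w ≡ true → w ∉ M → w ∈ C

  component-closed : ∀ M v → Closed M (component G M v)
  component-closed M v {w = w} u∈C uw w∉M = subst (w ∈_) stable (∈-grow⁺ u∈C uw w∉M)
    where
    stable : iter G (suc n) M (componentSeed M v) ≡ component G M v
    stable = iteration-stabilises (grow G M) (grow-inflationary M)
               (λ k → iter G k M (componentSeed M v)) (λ _ → refl)

  source∉ : ∀ {M u t} → PathAvoiding G M u t → u ∉ M
  source∉ (here u∉M)     = u∉M
  source∉ (step _ u∉M _) = u∉M

  Closed⇒source∈ : ∀ {M C u t} → Closed M C → PathAvoiding G M u t → t ∈ C → u ∈ C
  Closed⇒source∈ closed (here _)                   t∈C = t∈C
  Closed⇒source∈ closed (step {u} {w} uw u∉M path) t∈C =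
    closed (Closed⇒source∈ closed path t∈C) (trans (symmetric w u) uw) u∉M

  PathAvoiding-within : ∀ {M M′ C u t} → Closed M′ C → (∀ {v} → v ∈ C → v ∉ M) → u ∈ C →
                        PathAvoiding G M′ u t → PathAvoiding G M u t
  PathAvoiding-within closed C-avoids u∈C (here _)         = here (C-avoids u∈C)
  PathAvoiding-within closed C-avoids u∈C (step uw _ path) = step uw (C-avoids u∈C)
    (PathAvoiding-within closed C-avoids (closed u∈C uw (source∉ path)) path)

  PathAvoiding-join : ∀ {M u v w t} → PathAvoiding G M u v → adj v w ≡ true →
                      PathAvoiding G M w t → PathAvoiding G M u t
  PathAvoiding-join (here v∉M)          vw rest = step vw v∉M rest
  PathAvoiding-join (step uu′ u∉M path) vw rest = step uu′ u∉M (PathAvoiding-join path vw rest)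

  PathAvoiding-lastVisit : ∀ {M m u t} → t ≢ m → PathAvoiding G (M - m) u t →
                           PathAvoiding G M u t ⊎ ∃[ w ] adj m w ≡ true × PathAvoiding G M w t
  PathAvoiding-lastVisit t≢m (here t∉M-m) = inj₁ (here (x∉p-y∧x≢y⇒x∉p t∉M-m t≢m))
  PathAvoiding-lastVisit {m = m} t≢m (step {u} {w} uw u∉M-m path)
    with PathAvoiding-lastVisit t≢m path
  ... | inj₂ after-m = inj₂ after-m
  ... | inj₁ rest with u ≟ᶠ m
  ...   | yes refl = inj₂ (w , uw , rest)
  ...   | no  u≢m  = inj₁ (step uw (x∉p-y∧x≢y⇒x∉p u∉M-m u≢m) rest)

  PathAvoiding-throughVertex : ∀ {M m u t} → u ≢ m → t ≢ m → PathAvoiding G (M - m) u t →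
    PathAvoiding G M u t ⊎
    ∃₂ λ v w → PathAvoiding G M u v × adj v m ≡ true × adj m w ≡ true × PathAvoiding G M w t
  PathAvoiding-throughVertex u≢m t≢m (here u∉M-m) = inj₁ (here (x∉p-y∧x≢y⇒x∉p u∉M-m u≢m))
  PathAvoiding-throughVertex {M} {m} {u} {t} u≢m t≢m (step {w = w} uw u∉M-m path) = extend (w ≟ᶠ m)
    where
    u∉M : u ∉ M
    u∉M = x∉p-y∧x≢y⇒x∉p u∉M-m u≢m

    extend : Dec (w ≡ m) → PathAvoiding G M u t ⊎
      ∃₂ λ v w′ → PathAvoiding G M u v × adj v m ≡ true × adj m w′ ≡ true × PathAvoiding G M w′ t
    extend (yes refl) with PathAvoiding-lastVisit t≢m path
    ... | inj₁ rest              = inj₁ (step uw u∉M rest)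
    ... | inj₂ (w′ , mw′ , rest) = inj₂ (u , w′ , here u∉M , uw , mw′ , rest)
    extend (no w≢m) with PathAvoiding-throughVertex w≢m t≢m path
    ... | inj₁ rest                      = inj₁ (step uw u∉M rest)
    ... | inj₂ (v , w′ , before , after) = inj₂ (v , w′ , step uw u∉M before , after)

∈terminalList⇒∈terminals : ∀ (B : Pairs n) → x ∈ₗ terminalList B → x ∈ terminals B
∈terminalList⇒∈terminals ((a , b) ∷ B) (here refl)         = x∈p∪q⁺ (inj₁ (x∈⁅x⁆ a))
∈terminalList⇒∈terminals ((a , b) ∷ B) (there (here refl)) = x∈p∪q⁺ (inj₂ (x∈p∪q⁺ (inj₁ (x∈⁅x⁆ b))))
∈terminalList⇒∈terminals ((a , b) ∷ B) (there (there x∈B)) =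
  x∈p∪q⁺ (inj₂ (x∈p∪q⁺ (inj₂ (∈terminalList⇒∈terminals B x∈B))))

pair∈⇒∈terminalList : ∀ {B : Pairs n} {s t} → (s , t) ∈ₗ B →
                      s ∈ₗ terminalList B × t ∈ₗ terminalList B
pair∈⇒∈terminalList (here refl) = here refl , there (here refl)
pair∈⇒∈terminalList (there st∈B) =
  let s∈T , t∈T = pair∈⇒∈terminalList st∈B in there (there s∈T) , there (there t∈T)

module _ (G : Graph n) (B : Pairs n) where

  terminal∉multicut : ∀ {M} → IsNodeMulticut G B M → x ∈ₗ terminalList B → x ∉ M
  terminal∉multicut (M-avoidsT , _) x∈T x∈M = M-avoidsT _ x∈M (∈terminalList⇒∈terminals B x∈T)

  TerminalComponentsAvoid : Subset n → Subset n → Set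
  TerminalComponentsAvoid M′ M = ∀ {s v} → s ∈ₗ terminalList B → v ∈ component G M′ s → v ∉ M

  module _ {M M′ : Subset n} (M′-multicut : IsNodeMulticut G B M′)
           (avoids : TerminalComponentsAvoid M′ M) where

    transfer-fromTerminal : ∀ {s v} → s ∈ₗ terminalList B →
                            PathAvoiding G M′ s v → PathAvoiding G M s v
    transfer-fromTerminal {s} s∈T = PathAvoiding-within G (component-closed G M′ s) (avoids s∈T)
      (component-self G M′ s (terminal∉multicut M′-multicut s∈T))

    transfer-toTerminal : ∀ {w t} → t ∈ₗ terminalList B →
                          PathAvoiding G M′ w t → PathAvoiding G M w t
    transfer-toTerminal {t = t} t∈T path =
      PathAvoiding-within G closed (avoids t∈T) (Closed⇒source∈ G closed path t∈C) path
      where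
      closed : Closed G M′ (component G M′ t)
      closed = component-closed G M′ t
      t∈C : t ∈ component G M′ t
      t∈C = component-self G M′ t (terminal∉multicut M′-multicut t∈T)

    multicut-minus : ∀ {m} → IsNodeMulticut G B M → m ∈ M′ → m ∉ M → IsNodeMulticut G B (M′ - m)
    multicut-minus {m} (_ , M-cuts) m∈M′ m∉M =
      (λ v v∈M′-m → proj₁ M′-multicut v (p⊂q⇒p⊆q (x∈p⇒p-x⊂p m∈M′) v∈M′-m)) , cuts
      where
      cuts : ∀ s t → (s , t) ∈ₗ B → ¬ PathAvoiding G (M′ - m) s t
      cuts s t st∈B path =
        [ proj₂ M′-multicut s t st∈B
        , (λ (_ , _ , before , vm , mw , after) → M-cuts s t st∈B
            (PathAvoiding-join G (transfer-fromTerminal s∈T before) vm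
              (step mw m∉M (transfer-toTerminal t∈T after))))
        ]′ (PathAvoiding-throughVertex G (terminal≢m s∈T) (terminal≢m t∈T) path)
        where
        s∈T : s ∈ₗ terminalList B
        s∈T = proj₁ (pair∈⇒∈terminalList st∈B)
        t∈T : t ∈ₗ terminalList B
        t∈T = proj₂ (pair∈⇒∈terminalList st∈B)
        terminal≢m : ∀ {x} → x ∈ₗ terminalList B → x ≢ m
        terminal≢m x∈T refl = terminal∉multicut M′-multicut x∈T m∈M′

  minimal⇒⊆ : ∀ {M M′} → IsMinimalNodeMulticut G B M′ → IsNodeMulticut G B M →
              TerminalComponentsAvoid M′ M → M′ ⊆ M
  minimal⇒⊆ {M} {M′} (M′-multicut , M′-minimal) M-multicut avoids {m} m∈M′ =
    decidable-stable (m ∈? M) λ m∉M →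
      M′-minimal (M′ - m) (x∈p⇒p-x⊂p m∈M′) (multicut-minus M′-multicut avoids M-multicut m∈M′ m∉M)

  minimal-⊆⇒≡ : ∀ {M M′} → IsMinimalNodeMulticut G B M → IsNodeMulticut G B M′ → M′ ⊆ M → M′ ≡ M
  minimal-⊆⇒≡ (_ , M-minimal) M′-multicut M′⊆M with ⊆⇒≡⊎⊂ M′⊆M
  ... | inj₁ M′≡M = M′≡M
  ... | inj₂ M′⊂M = contradiction M′-multicut (M-minimal _ M′⊂M)

  ∈-dedup⁻ : ∀ (Cs : List (Subset n)) {C} → C ∈ₗ dedup G Cs → C ∈ₗ Cs
  ∈-dedup⁻ (D ∷ Cs) (here C≡D)   = here C≡D
  ∈-dedup⁻ (D ∷ Cs) (there C∈Cs) = there (∈-dedup⁻ Cs (proj₁ (∈-filter⁻ _ C∈Cs)))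

  ∈-dedup⁺ : ∀ (Cs : List (Subset n)) {C} → C ∈ₗ Cs → C ∈ₗ dedup G Cs
  ∈-dedup⁺ (D ∷ Cs) (here C≡D) = here C≡D
  ∈-dedup⁺ (D ∷ Cs) {C} (there C∈Cs) with ≡-dec _≟ᵇ_ D C
  ... | yes refl = here refl
  ... | no  D≢C  = there (∈-filter⁺ _ (∈-dedup⁺ Cs C∈Cs) D≢C)

  ∈-terminalComponents⁺ : ∀ {M s} → s ∈ₗ terminalList B →
                          component G M s ∈ₗ terminalComponents G B M
  ∈-terminalComponents⁺ {M} s∈T = ∈-dedup⁺ _ (∈-map⁺ (component G M) s∈T)

  ∈-terminalComponents⁻ : ∀ {M C} → C ∈ₗ terminalComponents G B M →
                          ∃[ s ] s ∈ₗ terminalList B × C ≡ component G M s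
  ∈-terminalComponents⁻ C∈ = ∈-map⁻ _ (∈-dedup⁻ _ C∈)

  ∈-allComponents⁺ : ∀ {M v} → v ∉ M → component G M v ∈ₗ allComponents G M
  ∈-allComponents⁺ {M} {v} v∉M =
    ∈-map⁺ (component G M) (∈-filter⁺ (λ u → lookup M u ≟ᵇ false) (∈-allFin v) (∉⇒lookup≡false v∉M))

  ∈-allComponents⁻ : ∀ {M C} → C ∈ₗ allComponents G M → ∃[ v ] C ≡ component G M v
  ∈-allComponents⁻ C∈ = let v , _ , C≡ = ∈-map⁻ _ C∈ in v , C≡

  module _ (σ : Fin n → Fin n) where
    open Ordered G σ

    -- argminStep agrees, clause by clause, with the step function local to mcc.
    mcc≡argmin : ∀ C′ M → mcc C′ M ≡
                 fromMaybe ⊥ (argmin (lexLess (λ C → ∣ C′ ∩ ∁ C ∣) minRank) (allComponents G M))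
    mcc≡argmin C′ M = cong (fromMaybe ⊥)
      (foldr-cong (λ { C nothing → refl ; C (just D) → refl }) refl (allComponents G M))

    mcc-avoids : ∀ C′ M {v} → v ∈ mcc C′ M → v ∉ M
    mcc-avoids C′ M {v} v∈mcc =
      let C , eq , v∈C = ∈-fromMaybe⊥ (subst (v ∈_) (mcc≡argmin C′ M) v∈mcc)
          u , C≡       = ∈-allComponents⁻ (argmin-∈ _ _ eq)
      in component-avoids G M u (subst (v ∈_) C≡ v∈C)

    mcc-minimal : ∀ C′ M {C} → C ∈ₗ allComponents G M → ∣ C′ ∩ ∁ (mcc C′ M) ∣ ≤ ∣ C′ ∩ ∁ C ∣
    mcc-minimal C′ M C∈ =
      let D , eq , D≤C = argmin-minimal (λ C → ∣ C′ ∩ ∁ C ∣) minRank _ C∈ in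
      subst (λ D → ∣ C′ ∩ ∁ D ∣ ≤ _) (sym (trans (mcc≡argmin C′ M) (cong (fromMaybe ⊥) eq))) D≤C

    component-mcc-score≡0 : ∀ {M v} → v ∉ M → ∣ component G M v ∩ ∁ (mcc (component G M v) M) ∣ ≡ 0
    component-mcc-score≡0 {M} {v} v∉M = n≤0⇒n≡0 (≤-trans (mcc-minimal C M (∈-allComponents⁺ v∉M))
                                                 (≤-reflexive (∣p∩∁p∣≡0 C)))
      where
      C : Subset n
      C = component G M v

    dist-self : ∀ {M} → IsNodeMulticut G B M → dist B M M ≡ 0
    dist-self {M} M-multicut = sum-map-≡0⁺ _ _ λ C∈ →
      let s , s∈T , C≡ = ∈-terminalComponents⁻ C∈ in
      subst (λ C → ∣ C ∩ ∁ (mcc C M) ∣ ≡ 0) (sym C≡)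
            (component-mcc-score≡0 (terminal∉multicut M-multicut s∈T))

    dist≡0⇒TerminalComponentsAvoid : ∀ {M M′} → dist B M M′ ≡ 0 → TerminalComponentsAvoid M′ M
    dist≡0⇒TerminalComponentsAvoid {M} {M′} dist≡0 {s} s∈T v∈C =
      mcc-avoids C M (∣p∩∁q∣≡0⇒p⊆q score≡0 v∈C)
      where
      C : Subset n
      C = component G M′ s
      score≡0 : ∣ C ∩ ∁ (mcc C M) ∣ ≡ 0
      score≡0 = sum-map-≡0⁻ (λ C → ∣ C ∩ ∁ (mcc C M) ∣) _ dist≡0 (∈-terminalComponents⁺ s∈T)

lemma2 : {n : ℕ} (G : Graph n) → Connected G → (B : Pairs n) →
         (σ : Fin n → Fin n) → Injective _≡_ _≡_ σ →
         (M M' : Subset n) →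
         IsMinimalNodeMulticut G B M → IsMinimalNodeMulticut G B M' →
         (M ≡ M') ⇔ (Ordered.dist G σ B M M' ≡ 0)
lemma2 G _ B σ _ M M′ M-minimal M′-minimal = mk⇔
  (λ { refl → dist-self G B σ (proj₁ M-minimal) })
  (λ dist≡0 → sym (minimal-⊆⇒≡ G B M-minimal (proj₁ M′-minimal)
    (minimal⇒⊆ G B M′-minimal (proj₁ M-minimal) (dist≡0⇒TerminalComponentsAvoid G B σ dist≡0))))
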